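{- Let $a_0=0$ and, for $n\ge 1$, let $a_n$ be the $n$th entry of the infinite list $A$ defined below, and let $s_n=a_0+a_1+\cdots+a_n$. For each nonnegative integer $h$, let $k(h)=\max\{k\ge 0 : s_k\le 2^h\}$, and let $T^h$ be the complete binary tree of height $h$. Then for each nonnegative integer $h$, \[ \pi^*(T^h)\le 2^h-k(h). \]
   Context: The list $A$: let $A_1=(5)$ and for $k\ge 2$ let $A_k$ be the concatenation $A_{k-1},A_{k-1},(1)$ (so $A_2=(5,5,1)$, $A_3=(5,5,1,5,5,1,1)$). Each $A_{k-1}$ is a prefix of $A_k$, and $A$ is the limiting infinite list. A complete binary tree of height $h$ is a rooted tree in which every non-leaf vertex has exactly two children and all leaves are at distance $h$ from the root. A pebbling configuration on a graph $G=(V,E)$ is a function $f:V\to\mathbb{Z}_{\ge 0}$ (number of pebbles at each vertex). A pebbling move removes two pebbles from a vertex and places one pebble on an adjacent vertex. A configuration $f$ pebbles $G$ if for every vertex $v$ some (possibly empty) sequence of pebbling moves brings a pebble to $v$. The optimal pebbling number $\pi^*(G)$ is the minimum total number of pebbles $\sum_v f(v)$ over all configurations $f$ that pebble $G$. -}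

module Defs where

open import Data.Nat using (ℕ; zero; suc; _+_; _*_; _∸_; _^_; _≤_)
open import Data.Nat.ListAction using (sum)
open import Data.Fin using (Fin; toℕ; _≟_)
open import Data.List using (List; []; _∷_; _++_; map; allFin)
open import Data.Product using (Σ; ∃; _×_; _,_)
open import Data.Sum using (_⊎_)
open import Relation.Nullary using (¬_; yes; no)
open import Relation.Binary.PropositionalEquality using (_≡_)
open import Relation.Binary.Construct.Closure.ReflexiveTransitive using (Star)

-- The list A.  Ablock k = A_{k+1}  (so Ablock 0 = A_1 = (5)).

Ablock : ℕ → List ℕ
Ablock zero    = 5 ∷ []
Ablock (suc k) = Ablock k ++ (Ablock k ++ (1 ∷ []))

-- 0-indexed lookup with default 0 (only used at in-range indices).
at : List ℕ → ℕ → ℕ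
at []       _       = 0
at (x ∷ xs) zero    = x
at (x ∷ xs) (suc i) = at xs i

-- a 0 = 0;  for n ≥ 1, a n = n-th entry (1-indexed) of A, read off from
-- the prefix A_{n+1} = Ablock n, whose length 2^(n+1) - 1 ≥ n.
a : ℕ → ℕ
a zero    = 0
a (suc m) = at (Ablock (suc m)) m

s : ℕ → ℕ
s zero    = a 0
s (suc n) = s n + a (suc n)

IsKh : ℕ → ℕ → Set
IsKh h k = (s k ≤ 2 ^ h) × (∀ j → s j ≤ 2 ^ h → j ≤ k)

record Graph : Set₁ where
  field
    n   : ℕ
    Adj : Fin n → Fin n → Set
open Graph public

-- Complete binary tree of height h, heap-indexed: vertices 0 .. 2^(h+1)-2,
-- vertex 0 is the root, the children of i are 2i+1 and 2i+2.
ChildOf : ∀ {m} → Fin m → Fin m → Set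
ChildOf j i = (toℕ j ≡ 2 * toℕ i + 1) ⊎ (toℕ j ≡ 2 * toℕ i + 2)

T : ℕ → Graph
T h = record
  { n   = 2 ^ (suc h) ∸ 1
  ; Adj = λ u v → ChildOf u v ⊎ ChildOf v u
  }

Config : Graph → Set
Config G = Fin (n G) → ℕ

size : (G : Graph) → Config G → ℕ
size G f = sum (map f (allFin (n G)))

-- result of the pebbling move u → v applied to f  (u ≠ v for adjacent vertices)
move : (G : Graph) → Config G → Fin (n G) → Fin (n G) → Config G
move G f u v w with w ≟ u
... | yes _ = f u ∸ 2
... | no _ with w ≟ v
...   | yes _ = f v + 1
...   | no _  = f w

data Step (G : Graph) (f : Config G) : Config G → Set where
  step : (u v : Fin (n G)) → Adj G u v → 2 ≤ f u → Step G f (move G f u v)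

Reach : (G : Graph) → Config G → Config G → Set
Reach G = Star (Step G)

Pebbles : (G : Graph) → Config G → Set
Pebbles G f = ∀ v → ∃ λ g → Reach G f g × (1 ≤ g v)

IsOptimalPebblingNumber : Graph → ℕ → Set
IsOptimalPebblingNumber G p =
  (∃ λ f → Pebbles G f × size G f ≡ p) ×
  (∀ f → Pebbles G f → p ≤ size G f)

-- Put 2·d ℓ pebbles on every vertex of height ℓ and E more on the root.  A target is
-- reached by walking down from the root: at each step the subtree of the child away from
-- the target is gathered at that child, half of it is moved up, and then half of what lies
-- on the current vertex is moved down towards the target.  If a pebble at distance j from a
-- deepest leaf weighs 2^(h ∸ j) and a sibling subtree weighs what its root can gather, this
-- walk never loses weight, so E + weight d h ≥ 2^h suffices.  With E = 2^h ∸ weight d h the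
-- configuration has 2^h ∸ saving d h pebbles, and one unit of d at height h ∸ i ∸ 1
-- contributes |A_{i+1}| = 2^(i+1) ∸ 1 to the saving and sum A_{i+1} = 3·2^(i+1) ∸ 1 to the
-- weight.  Since A_{i+1} = A_i A_i (1), every prefix of A splits greedily into such blocks,
-- so the prefix of length k(h) yields a profile with saving k(h) and weight s_{k(h)} ≤ 2^h.

module Submission where

open import Defs
open import Data.Bool using (Bool; true; false; not)
open import Data.Fin as Fin using (Fin; toℕ)
open import Data.Fin.Properties using (toℕ-fromℕ<; toℕ-injective; toℕ<n)
open import Data.List using ([]; _∷_; _++_; length; take; tabulate)
open import Data.List.Properties using (map-tabulate; length-++; ++-assoc; ++-identityʳ)
open import Data.Nat using (ℕ; zero; suc; _+_; _*_; _∸_; _^_; _≤_; _<_; z≤n; s≤s; ⌊_/2⌋; _≟_; _<?_; _≤?_;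
                            _≤′_; ≤′-refl; ≤′-step)
open import Data.Nat.Induction using (<-rec)
open import Data.Nat.ListAction using (sum)
open import Data.Nat.ListAction.Properties using (sum-++)
open import Data.Nat.Properties
open import Data.Nat.Solver using (module +-*-Solver)
open import Data.Product using (∃; _×_; _,_; proj₂)
open import Data.Sum using (inj₁; inj₂)
open import Function using (_∘_; id)
open import Relation.Binary.Construct.Closure.ReflexiveTransitive using (ε; _◅_; _◅◅_)
open import Relation.Binary.PropositionalEquality
open import Relation.Nullary using (yes; no; contradiction)
open +-*-Solver

-- Reachability and transfers

-- Reachability is transitive, so Reachable G is an indexed monad; proofs below use do-notation.
Reachable : (G : Graph) → Config G → (Config G → Set) → Set
Reachable G f P = ∃ λ g → Reach G f g × P g

module _ {G : Graph} where

  pure : ∀ {P f} → P f → Reachable G f P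
  pure p = _ , ε , p

  _>>=_ : ∀ {P Q f} → Reachable G f P → (∀ {g} → P g → Reachable G g Q) → Reachable G f Q
  (_ , r , p) >>= k = let g , r′ , q = k p in g , r ◅◅ r′ , q

module _ (G : Graph) (f : Config G) (u v : Fin (n G)) where

  move-source : move G f u v u ≡ f u ∸ 2
  move-source with u Fin.≟ u
  ... | yes _   = refl
  ... | no  u≢u = contradiction refl u≢u

  move-target : u ≢ v → move G f u v v ≡ f v + 1
  move-target u≢v with v Fin.≟ u
  ... | yes v≡u = contradiction (sym v≡u) u≢v
  ... | no  _ with v Fin.≟ v
  ...   | yes _   = refl
  ...   | no  v≢v = contradiction refl v≢v

  move-other : ∀ w → w ≢ u → f w ≤ move G f u v w
  move-other w w≢u with w Fin.≟ u
  ... | yes w≡u = contradiction w≡u w≢u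
  ... | no  _ with w Fin.≟ v
  ...   | yes refl = m≤m+n (f w) 1
  ...   | no  _ = ≤-refl

transfer : ∀ {G u v} → Adj G u v → u ≢ v → ∀ a {g} → 2 * a ≤ g u →
           Reachable G g (λ g′ → g v + a ≤ g′ v × g u ∸ 2 * a ≤ g′ u × (∀ w → w ≢ u → g w ≤ g′ w))
transfer adj u≢v zero {g} _ = pure (≤-reflexive (+-identityʳ _) , ≤-refl , λ _ _ → ≤-refl)
transfer {G} {u} {v} adj u≢v (suc a) {g} 2[1+a]≤gu =
  let g′ , r , gain , loss , keep = transfer adj u≢v a 2a≤g₁u
  in  g′ , step u v adj 2≤gu ◅ r , gain′ gain , loss′ loss ,
      λ w w≢u → ≤-trans (move-other G g u v w w≢u) (keep w w≢u)
  where
    g₁ = move G g u v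
    2+2a≤gu : 2 + 2 * a ≤ g u
    2+2a≤gu = subst (_≤ g u) (*-suc 2 a) 2[1+a]≤gu
    2≤gu : 2 ≤ g u
    2≤gu = m+n≤o⇒m≤o 2 2+2a≤gu
    2a≤g₁u : 2 * a ≤ g₁ u
    2a≤g₁u = subst (2 * a ≤_) (sym (move-source G g u v))
               (m+n≤o⇒m≤o∸n (2 * a) (subst (_≤ g u) (+-comm 2 (2 * a)) 2+2a≤gu))
    gain′ : ∀ {x} → g₁ v + a ≤ x → g v + suc a ≤ x
    gain′ {x} = subst (_≤ x) (trans (cong (_+ a) (move-target G g u v u≢v)) (+-assoc (g v) 1 a))
    loss′ : ∀ {x} → g₁ u ∸ 2 * a ≤ x → g u ∸ 2 * suc a ≤ x
    loss′ {x} = subst (_≤ x) (trans (cong (_∸ 2 * a) (move-source G g u v))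
                                (trans (∸-+-assoc (g u) 2 (2 * a)) (cong (g u ∸_) (sym (*-suc 2 a)))))

2*⌊n/2⌋≤n : ∀ n → 2 * ⌊ n /2⌋ ≤ n
2*⌊n/2⌋≤n zero          = z≤n
2*⌊n/2⌋≤n (suc zero)    = z≤n
2*⌊n/2⌋≤n (suc (suc n)) = ≤-trans (≤-reflexive (*-suc 2 ⌊ n /2⌋)) (+-monoʳ-≤ 2 (2*⌊n/2⌋≤n n))

⌊n+2*m/2⌋≡⌊n/2⌋+m : ∀ n m → ⌊ n + 2 * m /2⌋ ≡ ⌊ n /2⌋ + m
⌊n+2*m/2⌋≡⌊n/2⌋+m n zero    = trans (cong ⌊_/2⌋ (+-identityʳ n)) (sym (+-identityʳ ⌊ n /2⌋))
⌊n+2*m/2⌋≡⌊n/2⌋+m n (suc m) = begin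
  ⌊ n + 2 * suc m /2⌋     ≡⟨ cong ⌊_/2⌋ shift ⟩
  suc ⌊ n + 2 * m /2⌋     ≡⟨ cong suc (⌊n+2*m/2⌋≡⌊n/2⌋+m n m) ⟩
  suc (⌊ n /2⌋ + m)       ≡⟨ +-suc ⌊ n /2⌋ m ⟨
  ⌊ n /2⌋ + suc m         ∎
  where
    open ≡-Reasoning
    shift : n + 2 * suc m ≡ 2 + (n + 2 * m)
    shift = solve 2 (λ n m → n :+ con 2 :* (con 1 :+ m) := con 2 :+ (n :+ con 2 :* m)) refl n m

halve-≤ : ∀ p n q → 2 * p ≤ n + 2 * q → p ≤ ⌊ n /2⌋ + q
halve-≤ p n q le = subst₂ _≤_ (⌊n+2*m/2⌋≡⌊n/2⌋+m 0 p) (⌊n+2*m/2⌋≡⌊n/2⌋+m n q) (⌊n/2⌋-mono le)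

log₂-bracket : ∀ k n → 1 ≤ n → n < 2 ^ suc k → ∃ λ e → e ≤ k × 2 ^ e ≤ n × n < 2 ^ suc e
log₂-bracket zero    n 1≤n n<2 = 0 , z≤n , 1≤n , n<2
log₂-bracket (suc k) n 1≤n n<2^k+2 with n <? 2 ^ suc k
... | yes n<2^k+1 = let e , e≤k , lo , hi = log₂-bracket k n 1≤n n<2^k+1
                    in  e , m≤n⇒m≤1+n e≤k , lo , hi
... | no  n≮2^k+1 = suc k , ≤-refl , ≮⇒≥ n≮2^k+1 , n<2^k+2

m∸[n+o]+n≡m∸o : ∀ m n o → n + o ≤ m → m ∸ (n + o) + n ≡ m ∸ o
m∸[n+o]+n≡m∸o m n o n+o≤m = begin
  m ∸ (n + o) + n    ≡⟨ cong (λ k → m ∸ k + n) (+-comm n o) ⟩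
  m ∸ (o + n) + n    ≡⟨ cong (_+ n) (∸-+-assoc m o n) ⟨
  m ∸ o ∸ n + n      ≡⟨ m∸n+n≡m (m+n≤o⇒m≤o∸n n n+o≤m) ⟩
  m ∸ o              ∎
  where open ≡-Reasoning

single : ℕ → ℕ → ℕ → ℕ
single zero    v zero    = v
single zero    v (suc w) = 0
single (suc x) v zero    = 0
single (suc x) v (suc w) = single x v w

single-self : ∀ x {v} → single x v x ≡ v
single-self zero    = refl
single-self (suc x) = single-self x

single-other : ∀ {x v w} → w ≢ x → single x v w ≡ 0
single-other {zero}  {w = zero}  w≢x = contradiction refl w≢x
single-other {zero}  {w = suc w} w≢x = refl
single-other {suc x} {w = zero}  w≢x = refl
single-other {suc x} {w = suc w} w≢x = single-other (w≢x ∘ cong suc)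

single-+ : ∀ x a b w → single x (a + b) w ≡ single x a w + single x b w
single-+ zero    a b zero    = refl
single-+ zero    a b (suc w) = refl
single-+ (suc x) a b zero    = refl
single-+ (suc x) a b (suc w) = single-+ x a b w

single-mono : ∀ x {a b} w → a ≤ b → single x a w ≤ single x b w
single-mono zero    zero    a≤b = a≤b
single-mono zero    (suc w) a≤b = z≤n
single-mono (suc x) zero    a≤b = z≤n
single-mono (suc x) (suc w) a≤b = single-mono x w a≤b

infixr 5 _⊕_
_⊕_ : (ℕ → ℕ) → (ℕ → ℕ) → ℕ → ℕ
(F ⊕ G) w = F w + G w

child : Bool → ℕ → ℕ
child false x = 2 * x + 1
child true  x = 2 * x + 2

child-≥ : ∀ b x → 2 * x + 1 ≤ child b x
child-≥ false x = ≤-refl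
child-≥ true  x = +-monoʳ-≤ (2 * x) (s≤s z≤n)

child-≤ : ∀ b x → child b x ≤ 2 * x + 2
child-≤ false x = +-monoʳ-≤ (2 * x) (s≤s z≤n)
child-≤ true  x = ≤-refl

x<child : ∀ b x → x < child b x
x<child b x = ≤-trans (≤-reflexive (+-comm 1 x)) (≤-trans (+-monoˡ-≤ 1 (m≤n*m x 2)) (child-≥ b x))

2+child≤ : ∀ b x → 2 + child b x ≤ 2 * (2 + x)
2+child≤ b x = ≤-trans (+-monoʳ-≤ 2 (child-≤ b x))
  (≤-reflexive (solve 1 (λ x → con 2 :+ (con 2 :* x :+ con 2) := con 2 :* (con 2 :+ x)) refl x))

left-start : ∀ x p → (1 + child false x) * p ≡ (1 + x) * (2 * p)
left-start = solve 2 (λ x p → (con 1 :+ (con 2 :* x :+ con 1)) :* p := (con 1 :+ x) :* (con 2 :* p))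
               refl

right-start : ∀ x p → (1 + child true x) * p ≡ (2 + child false x) * p
right-start = solve 2 (λ x p → (con 1 :+ (con 2 :* x :+ con 2)) :* p := (con 2 :+ (con 2 :* x :+ con 1)) :* p)
                refl

right-end : ∀ x p → (2 + child true x) * p ≡ (2 + x) * (2 * p)
right-end = solve 2 (λ x p → (con 2 :+ (con 2 :* x :+ con 2)) :* p := (con 2 :+ x) :* (con 2 :* p))
              refl

data InSubtree : ℕ → ℕ → ℕ → Set where
  here  : ∀ {m x} → InSubtree m x x
  below : ∀ {m x w} b → InSubtree m (child b x) w → InSubtree (suc m) x w

depth-range : ∀ e m x w → e ≤ m → (1 + x) * 2 ^ e ≤ 1 + w → 1 + w < (2 + x) * 2 ^ e → InSubtree m x w
depth-range zero m x w _ lo hi = subst (InSubtree m x) (≤-antisym x≤w w≤x) here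
  where
    x≤w = ≤-pred (≤-trans (≤-reflexive (sym (*-identityʳ (1 + x)))) lo)
    w≤x = ≤-pred (≤-pred (≤-trans hi (≤-reflexive (*-identityʳ (2 + x)))))
depth-range (suc e) (suc m) x w (s≤s e≤m) lo hi with 1 + w <? (2 + child false x) * 2 ^ e
... | yes in-left = below false (depth-range e m (child false x) w e≤m
                                   (≤-trans (≤-reflexive (left-start x (2 ^ e))) lo) in-left)
... | no  in-right = below true (depth-range e m (child true x) w e≤m
                                    (≤-trans (≤-reflexive (right-start x (2 ^ e))) (≮⇒≥ in-right))
                                    (≤-trans hi (≤-reflexive (sym (right-end x (2 ^ e))))))

layered : (ℕ → ℕ) → ℕ → ℕ → ℕ → ℕ
layered d zero    x = single x (2 * d 0)
layered d (suc m) x = single x (2 * d (suc m)) ⊕ layered d m (child false x) ⊕ layered d m (child true x)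

levelSum : (ℕ → ℕ) → ℕ → ℕ
levelSum d zero    = d 0
levelSum d (suc m) = levelSum d m + d (suc m)

weight : (ℕ → ℕ) → ℕ → ℕ
weight d zero    = 2 * d 0
weight d (suc m) = 2 * weight d m + levelSum d m + 2 * d (suc m)

saving : (ℕ → ℕ) → ℕ → ℕ
saving d zero    = 0
saving d (suc m) = 2 * saving d m + levelSum d m

pebbles : (ℕ → ℕ) → ℕ → ℕ
pebbles d zero    = 2 * d 0
pebbles d (suc m) = 2 * d (suc m) + (pebbles d m + pebbles d m)

levelSum-zero : ∀ m → levelSum (λ _ → 0) m ≡ 0
levelSum-zero zero    = refl
levelSum-zero (suc m) = trans (+-identityʳ _) (levelSum-zero m)

levelSum≡0⇒saving≡0×weight≡0 : ∀ d m → levelSum d m ≡ 0 → saving d m ≡ 0 × weight d m ≡ 0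
levelSum≡0⇒saving≡0×weight≡0 d zero    d0≡0 = refl , cong (2 *_) d0≡0
levelSum≡0⇒saving≡0×weight≡0 d (suc m) sum≡0
  with m+n≡0⇒m≡0 (levelSum d m) sum≡0 | m+n≡0⇒n≡0 (levelSum d m) sum≡0
... | lower≡0 | top≡0 with levelSum≡0⇒saving≡0×weight≡0 d m lower≡0
... | saving≡0 , weight≡0 rewrite lower≡0 | top≡0 | saving≡0 | weight≡0 = refl , refl

weight-suc : ∀ d m E → E + weight d (suc m) ≡ (E + 2 * d (suc m) + levelSum d m) + 2 * weight d m
weight-suc d m E = solve 4 (λ e w u t → e :+ (con 2 :* w :+ u :+ con 2 :* t) := e :+ con 2 :* t :+ u :+ con 2 :* w)
                     refl E (weight d m) (levelSum d m) (d (suc m))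

budget-root : ∀ d m E → 2 ^ suc m ≤ E + weight d (suc m) → 1 ≤ E + 2 * d (suc m) + levelSum d m
budget-root d m E budget with levelSum d m ≟ 0
... | no  sum≢0 = ≤-trans (n≢0⇒n>0 sum≢0) (m≤n+m (levelSum d m) (E + 2 * d (suc m)))
... | yes sum≡0 = ≤-trans (m^n>0 2 (suc m)) (≤-trans budget (≤-reflexive (begin
  E + weight d (suc m)      ≡⟨ weight-suc d m E ⟩
  X + 2 * weight d m        ≡⟨ cong (λ w → X + 2 * w) (proj₂ (levelSum≡0⇒saving≡0×weight≡0 d m sum≡0)) ⟩
  X + 0                     ≡⟨ +-identityʳ X ⟩
  X                         ∎)))
  where
    open ≡-Reasoning
    X = E + 2 * d (suc m) + levelSum d m

budget-child : ∀ d m E → 2 ^ suc m ≤ E + weight d (suc m) →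
               2 ^ m ≤ ⌊ E + 2 * d (suc m) + levelSum d m /2⌋ + weight d m
budget-child d m E budget = halve-≤ (2 ^ m) _ (weight d m) (≤-trans budget (≤-reflexive (weight-suc d m E)))

-- Pebbling the complete binary tree

module HeapTree (h : ℕ) where

  N : ℕ
  N = n (T h)

  infix 4 _⊑_
  _⊑_ : (ℕ → ℕ) → Config (T h) → Set
  F ⊑ g = ∀ w → F (toℕ w) ≤ g w

  ⊑-mono : ∀ {F F′ g} → (∀ w → F w ≤ F′ w) → F′ ⊑ g → F ⊑ g
  ⊑-mono F≤F′ le w = ≤-trans (F≤F′ (toℕ w)) (le w)

  ⊑-≗ : ∀ {F F′ g} → (∀ w → F w ≡ F′ w) → F′ ⊑ g → F ⊑ g
  ⊑-≗ F≗F′ = ⊑-mono (≤-reflexive ∘ F≗F′)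

  -- The subtree of height m rooted at heap number x lies inside T h.
  record Fits (m x : ℕ) : Set where
    constructor fits
    field bound : (2 + x) * 2 ^ m ≤ 2 ^ suc h

  fits⇒< : ∀ {m x} → Fits m x → x < N
  fits⇒< {m} {x} (fits bound) =
    m+n≤o⇒m≤o∸n (suc x) (≤-trans (≤-reflexive (+-comm (suc x) 1)) (≤-trans (m≤m*n (2 + x) (2 ^ m)) bound))
    where instance _ = m^n≢0 2 m

  fits-child : ∀ {m x} b → Fits (suc m) x → Fits m (child b x)
  fits-child {m} {x} b (fits bound) =
    fits (≤-trans (*-monoˡ-≤ (2 ^ m) (2+child≤ b x)) (≤-trans (≤-reflexive eq) bound))
    where
      eq : 2 * (2 + x) * 2 ^ m ≡ (2 + x) * 2 ^ suc m
      eq = solve 2 (λ x p → con 2 :* (con 2 :+ x) :* p := (con 2 :+ x) :* (con 2 :* p)) refl x (2 ^ m)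

  in-root-subtree : ∀ (t : Fin N) → InSubtree h 0 (toℕ t)
  in-root-subtree t =
    let e , e≤h , lo , hi = log₂-bracket h (1 + toℕ t) (s≤s z≤n) 2+t≤2^h+1
    in  depth-range e h 0 (toℕ t) e≤h (≤-trans (≤-reflexive (*-identityˡ (2 ^ e))) lo) hi
    where
      2+t≤2^h+1 : 2 + toℕ t ≤ 2 ^ suc h
      2+t≤2^h+1 = ≤-trans (≤-reflexive (+-comm 1 (suc (toℕ t))))
                    (≤-trans (+-monoˡ-≤ 1 (toℕ<n t)) (≤-reflexive (m∸n+n≡m (m^n>0 2 (suc h)))))

  vertex : ∀ {m x} → Fits m x → Fin N
  vertex f = Fin.fromℕ< (fits⇒< f)

  toℕ-vertex : ∀ {m x} (f : Fits m x) → toℕ (vertex f) ≡ x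
  toℕ-vertex f = toℕ-fromℕ< (fits⇒< f)

  record Edge (u v : ℕ) : Set where
    constructor edge
    field
      {U V} : Fin N
      U≡u   : toℕ U ≡ u
      V≡v   : toℕ V ≡ v
      adj   : Adj (T h) U V

  childOf : ∀ b {U V : Fin N} → toℕ U ≡ child b (toℕ V) → ChildOf U V
  childOf false = inj₁
  childOf true  = inj₂

  childOf⇒≢ : ∀ {U V : Fin N} → ChildOf U V → toℕ U ≢ toℕ V
  childOf⇒≢ (inj₁ U≡) U≡V = <⇒≢ (x<child false _) (trans (sym U≡V) U≡)
  childOf⇒≢ (inj₂ U≡) U≡V = <⇒≢ (x<child true _) (trans (sym U≡V) U≡)

  child-edge : ∀ {m x} b (f : Fits (suc m) x) → Edge (child b x) x
  child-edge b f = edge (toℕ-vertex f′) (toℕ-vertex f)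
                        (inj₁ (childOf b (trans (toℕ-vertex f′) (cong (child b) (sym (toℕ-vertex f))))))
    where f′ = fits-child b f

  parent-edge : ∀ {m x} b (f : Fits (suc m) x) → Edge x (child b x)
  parent-edge b f with child-edge b f
  ... | edge U≡ V≡ (inj₁ U→V) = edge V≡ U≡ (inj₂ U→V)
  ... | edge U≡ V≡ (inj₂ V→U) = edge V≡ U≡ (inj₁ V→U)

  adj⇒≢ : ∀ {U V} → Adj (T h) U V → toℕ U ≢ toℕ V
  adj⇒≢ (inj₁ U→V) = childOf⇒≢ U→V
  adj⇒≢ (inj₂ V→U) = childOf⇒≢ V→U ∘ sym

  transfer⊑ : ∀ {u v} a e {g} → Edge u v → single u (2 * a) ⊕ e ⊑ g →
              Reachable (T h) g (single v a ⊕ e ⊑_)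
  transfer⊑ a e {g} (edge {U} {V} refl refl adj) le =
    let g′ , r , gain , loss , keep = transfer adj (u≢v ∘ cong toℕ) a 2a≤gU
    in  g′ , r , bound gain loss keep
    where
      u≢v = adj⇒≢ adj
      u = toℕ U
      v = toℕ V
      at-U : 2 * a + e u ≤ g U
      at-U = subst (λ k → k + e u ≤ g U) (single-self u) (le U)
      2a≤gU : 2 * a ≤ g U
      2a≤gU = m+n≤o⇒m≤o (2 * a) at-U
      at-V : e v ≤ g V
      at-V = subst (λ k → k + e v ≤ g V) (single-other (u≢v ∘ sym)) (le V)
      bound : ∀ {g′} → g V + a ≤ g′ V → g U ∸ 2 * a ≤ g′ U → (∀ w → w ≢ U → g w ≤ g′ w) →
              single v a ⊕ e ⊑ g′
      bound {g′} gain loss keep w with w Fin.≟ V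
      ... | yes refl = subst (λ k → k + e v ≤ g′ V) (sym (single-self v))
                         (≤-trans (≤-reflexive (+-comm a (e v))) (≤-trans (+-monoˡ-≤ a at-V) gain))
      ... | no w≢V rewrite single-other {v} {a} (w≢V ∘ toℕ-injective) with w Fin.≟ U
      ...   | yes refl = ≤-trans (m+n≤o⇒m≤o∸n (e u) (subst (_≤ g U) (+-comm (2 * a) (e u)) at-U)) loss
      ...   | no w≢U = ≤-trans (m≤n+m (e (toℕ w)) _) (≤-trans (le w) (keep w w≢U))

module LayeredPebbling (h : ℕ) (d : ℕ → ℕ) where
  open HeapTree h

  layered-split : ∀ m x b w → layered d (suc m) x w ≡
                  single x (2 * d (suc m)) w + (layered d m (child (not b) x) w + layered d m (child b x) w)
  layered-split m x false w =
    cong (single x (2 * d (suc m)) w +_) (+-comm (layered d m (child false x) w) (layered d m (child true x) w))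
  layered-split m x true  w = refl

  mutual
    gather : ∀ m {x} → Fits m x → ∀ e {g} → layered d m x ⊕ e ⊑ g →
             Reachable (T h) g (single x (2 * levelSum d m) ⊕ e ⊑_)
    gather zero    f e le = pure le
    gather (suc m) {x} f e le = do
      le₁ ← gather-to-parent m false f (R ⊕ c ⊕ e) (⊑-≗ split le)
      le₂ ← gather-to-parent m true f (U ⊕ c ⊕ e) (⊑-≗ swap le₁)
      pure (⊑-≗ merge le₂)
      where
        c = single x (2 * d (suc m))
        U = single x (levelSum d m)
        L = layered d m (child false x)
        R = layered d m (child true x)
        split : ∀ w → L w + (R w + (c w + e w)) ≡ c w + (L w + R w) + e w
        split w = solve 4 (λ l r c e → l :+ (r :+ (c :+ e)) := c :+ (l :+ r) :+ e) refl
                    (L w) (R w) (c w) (e w)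
        swap : ∀ w → R w + (U w + (c w + e w)) ≡ U w + (R w + (c w + e w))
        swap w = solve 3 (λ r u ce → r :+ (u :+ ce) := u :+ (r :+ ce)) refl (R w) (U w) (c w + e w)
        merge : ∀ w → single x (2 * levelSum d (suc m)) w + e w ≡ U w + (U w + (c w + e w))
        merge w rewrite *-distribˡ-+ 2 (levelSum d m) (d (suc m))
                      | single-+ x (2 * levelSum d m) (2 * d (suc m)) w
                      | single-+ x (levelSum d m) (levelSum d m + 0) w
                      | +-identityʳ (levelSum d m) =
          solve 4 (λ u₁ u₂ c e → u₁ :+ u₂ :+ c :+ e := u₁ :+ (u₂ :+ (c :+ e))) refl (U w) (U w) (c w) (e w)

    gather-to-parent : ∀ m b {x} → Fits (suc m) x → ∀ e {g} → layered d m (child b x) ⊕ e ⊑ g →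
                       Reachable (T h) g (single x (levelSum d m) ⊕ e ⊑_)
    gather-to-parent m b f e le = do
      le₁ ← gather m (fits-child b f) e le
      transfer⊑ (levelSum d m) e (child-edge b f) le₁

  gather-sparing : ∀ m {x} → Fits (suc m) x → ∀ b E {g} → single x E ⊕ layered d (suc m) x ⊑ g →
                   Reachable (T h) g (single x (E + 2 * d (suc m) + levelSum d m) ⊕ layered d m (child b x) ⊑_)
  gather-sparing m {x} f b E le = do
    le₁ ← gather-to-parent m (not b) f (single x (E + 2 * d (suc m)) ⊕ K) (⊑-≗ split le)
    pure (⊑-≗ merge le₁)
    where
      K = layered d m (child b x)
      O = layered d m (child (not b) x)
      split : ∀ w → O w + (single x (E + 2 * d (suc m)) w + K w) ≡ single x E w + layered d (suc m) x w
      split w rewrite layered-split m x b w | single-+ x E (2 * d (suc m)) w =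
        solve 4 (λ o e c k → o :+ (e :+ c :+ k) := e :+ (c :+ (o :+ k))) refl
          (O w) (single x E w) (single x (2 * d (suc m)) w) (K w)
      merge : ∀ w → single x (E + 2 * d (suc m) + levelSum d m) w + K w ≡
                    single x (levelSum d m) w + (single x (E + 2 * d (suc m)) w + K w)
      merge w rewrite single-+ x (E + 2 * d (suc m)) (levelSum d m) w =
        solve 3 (λ a u k → a :+ u :+ k := u :+ (a :+ k)) refl
          (single x (E + 2 * d (suc m)) w) (single x (levelSum d m) w) (K w)

  pebble-subtree : ∀ m {x} → Fits m x → ∀ E {g} → single x E ⊕ layered d m x ⊑ g → 2 ^ m ≤ E + weight d m →
                   ∀ t → InSubtree m x (toℕ t) → Reachable (T h) g (λ g′ → 1 ≤ g′ t)
  pebble-subtree zero f E {g} le budget t here =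
    pure (≤-trans budget (subst (_≤ g t) (cong₂ _+_ (single-self (toℕ t)) (single-self (toℕ t))) (le t)))
  pebble-subtree (suc m) f E le budget t here = do
    le₁ ← gather-sparing m f false E le
    pure (≤-trans (budget-root d m E budget)
                  (subst (_≤ _) (single-self (toℕ t)) (m+n≤o⇒m≤o _ (le₁ t))))
  pebble-subtree (suc m) {x} f E le budget t (below b t∈) = do
    le₁ ← gather-sparing m f b E le
    le₂ ← transfer⊑ ⌊ X /2⌋ K (parent-edge b f) (⊑-mono (λ w → +-monoˡ-≤ (K w) (half w)) le₁)
    pebble-subtree m (fits-child b f) ⌊ X /2⌋ le₂ (budget-child d m E budget) t t∈
    where
      X = E + 2 * d (suc m) + levelSum d m
      K = layered d m (child b x)
      half : ∀ w → single x (2 * ⌊ X /2⌋) w ≤ single x X w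
      half w = single-mono x w (2*⌊n/2⌋≤n X)

  layered-pebbles : ∀ E → 2 ^ h ≤ E + weight d h → Pebbles (T h) (λ w → (single 0 E ⊕ layered d h 0) (toℕ w))
  layered-pebbles E budget t = pebble-subtree h (fits ≤-refl) E (λ _ → ≤-refl) budget t (in-root-subtree t)

sumBelow : ℕ → (ℕ → ℕ) → ℕ
sumBelow n F = sum (tabulate {n = n} (F ∘ toℕ))

sumBelow-⊕ : ∀ n F G → sumBelow n (F ⊕ G) ≡ sumBelow n F + sumBelow n G
sumBelow-⊕ zero    F G = refl
sumBelow-⊕ (suc n) F G rewrite sumBelow-⊕ n (F ∘ suc) (G ∘ suc) =
  solve 4 (λ f g fs gs → f :+ g :+ (fs :+ gs) := f :+ fs :+ (g :+ gs)) refl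
    (F 0) (G 0) (sumBelow n (F ∘ suc)) (sumBelow n (G ∘ suc))

sumBelow-zero : ∀ n → sumBelow n (λ _ → 0) ≡ 0
sumBelow-zero zero    = refl
sumBelow-zero (suc n) = sumBelow-zero n

sumBelow-single : ∀ n x v → sumBelow n (single x v) ≤ v
sumBelow-single zero    x       v = z≤n
sumBelow-single (suc n) zero    v = ≤-reflexive (trans (cong (v +_) (sumBelow-zero n)) (+-identityʳ v))
sumBelow-single (suc n) (suc x) v = sumBelow-single n x v

sumBelow-layered : ∀ n d m x → sumBelow n (layered d m x) ≤ pebbles d m
sumBelow-layered n d zero    x = sumBelow-single n x (2 * d 0)
sumBelow-layered n d (suc m) x
  rewrite sumBelow-⊕ n (single x (2 * d (suc m))) (layered d m (child false x) ⊕ layered d m (child true x))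
        | sumBelow-⊕ n (layered d m (child false x)) (layered d m (child true x))
  = +-mono-≤ (sumBelow-single n x _) (+-mono-≤ (sumBelow-layered n d m _) (sumBelow-layered n d m _))

size-layered : ∀ h d E → size (T h) ((single 0 E ⊕ layered d h 0) ∘ toℕ) ≤ E + pebbles d h
size-layered h d E = begin
  size (T h) (F ∘ toℕ)                                   ≡⟨ cong sum (map-tabulate {n = N} id (F ∘ toℕ)) ⟩
  sumBelow N F                                           ≡⟨ sumBelow-⊕ N (single 0 E) (layered d h 0) ⟩
  sumBelow N (single 0 E) + sumBelow N (layered d h 0)   ≤⟨ +-mono-≤ (sumBelow-single N 0 E) (sumBelow-layered N d h 0) ⟩
  E + pebbles d h                                        ∎
  where
    open ≤-Reasoning
    N = n (T h)
    F = single 0 E ⊕ layered d h 0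

len : ℕ → ℕ
len i = length (Ablock i)

len-suc : ∀ i → len (suc i) ≡ len i + (len i + 1)
len-suc i = trans (length-++ (Ablock i)) (cong (len i +_) (length-++ (Ablock i)))

sum-suc : ∀ i → sum (Ablock (suc i)) ≡ sum (Ablock i) + (sum (Ablock i) + 1)
sum-suc i = trans (sum-++ (Ablock i) _) (cong (sum (Ablock i) +_) (sum-++ (Ablock i) (1 ∷ [])))

2*[3*p]≡3*[2*p] : ∀ p → 2 * (3 * p) ≡ 3 * (2 * p)
2*[3*p]≡3*[2*p] = solve 1 (λ p → con 2 :* (con 3 :* p) := con 3 :* (con 2 :* p)) refl

x+[x+1]+1≡2*[x+1] : ∀ x → x + (x + 1) + 1 ≡ 2 * (x + 1)
x+[x+1]+1≡2*[x+1] = solve 1 (λ x → x :+ (x :+ con 1) :+ con 1 := con 2 :* (x :+ con 1)) refl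

len+1≡2^ : ∀ i → len i + 1 ≡ 2 ^ suc i
len+1≡2^ zero    = refl
len+1≡2^ (suc i) = begin
  len (suc i) + 1            ≡⟨ cong (_+ 1) (len-suc i) ⟩
  len i + (len i + 1) + 1    ≡⟨ x+[x+1]+1≡2*[x+1] (len i) ⟩
  2 * (len i + 1)            ≡⟨ cong (2 *_) (len+1≡2^ i) ⟩
  2 ^ suc (suc i)            ∎
  where open ≡-Reasoning

sum+1≡3*2^ : ∀ i → sum (Ablock i) + 1 ≡ 3 * 2 ^ suc i
sum+1≡3*2^ zero    = refl
sum+1≡3*2^ (suc i) = begin
  sum (Ablock (suc i)) + 1                       ≡⟨ cong (_+ 1) (sum-suc i) ⟩
  sum (Ablock i) + (sum (Ablock i) + 1) + 1      ≡⟨ x+[x+1]+1≡2*[x+1] (sum (Ablock i)) ⟩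
  2 * (sum (Ablock i) + 1)                       ≡⟨ cong (2 *_) (sum+1≡3*2^ i) ⟩
  2 * (3 * 2 ^ suc i)                            ≡⟨ 2*[3*p]≡3*[2*p] (2 ^ suc i) ⟩
  3 * 2 ^ suc (suc i)                            ∎
  where open ≡-Reasoning

2^suc≤sum-Ablock : ∀ i → 2 ^ suc i ≤ sum (Ablock i)
2^suc≤sum-Ablock zero    = s≤s (s≤s z≤n)
2^suc≤sum-Ablock (suc i) =
  ≤-trans (+-mono-≤ (2^suc≤sum-Ablock i) (+-mono-≤ (2^suc≤sum-Ablock i) z≤n)) (≤-reflexive (sym (sum-suc i)))

n<len : ∀ n → n < len n
n<len zero    = s≤s z≤n
n<len (suc n) = begin-strict
  suc n                ≡⟨ +-comm 1 n ⟩
  n + 1                <⟨ +-monoˡ-< 1 (n<len n) ⟩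
  len n + 1            ≤⟨ m≤n+m (len n + 1) (len n) ⟩
  len n + (len n + 1)  ≡⟨ len-suc n ⟨
  len (suc n)          ∎
  where open ≤-Reasoning

Ablock-prefix : ∀ {i j} → i ≤′ j → ∃ λ ys → Ablock j ≡ Ablock i ++ ys
Ablock-prefix ≤′-refl = [] , sym (++-identityʳ _)
Ablock-prefix {i} (≤′-step {j} i≤′j) =
  let ys , eq = Ablock-prefix i≤′j
  in  ys ++ (Ablock j ++ 1 ∷ []) , trans (cong (_++ (Ablock j ++ 1 ∷ [])) eq) (++-assoc (Ablock i) ys _)

at-++ˡ : ∀ xs ys {p} → p < length xs → at (xs ++ ys) p ≡ at xs p
at-++ˡ (x ∷ xs) ys {zero}  _         = refl
at-++ˡ (x ∷ xs) ys {suc p} (s≤s p<) = at-++ˡ xs ys p<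

a≡at : ∀ i p → p < len i → a (suc p) ≡ at (Ablock i) p
a≡at i p p<len with ≤-total i (suc p)
... | inj₁ i≤ = let ys , eq = Ablock-prefix (≤⇒≤′ i≤)
                in  trans (cong (λ xs → at xs p) eq) (at-++ˡ (Ablock i) ys p<len)
... | inj₂ ≤i = let ys , eq = Ablock-prefix (≤⇒≤′ ≤i)
                in  sym (trans (cong (λ xs → at xs p) eq) (at-++ˡ (Ablock (suc p)) ys p<len′))
  where p<len′ = <-trans (n<1+n p) (n<len (suc p))

sum-take-suc : ∀ xs {n} → n < length xs → sum (take (suc n) xs) ≡ sum (take n xs) + at xs n
sum-take-suc (x ∷ xs) {zero}  _         = +-identityʳ x
sum-take-suc (x ∷ xs) {suc n} (s≤s n<) = trans (cong (x +_) (sum-take-suc xs n<)) (sym (+-assoc x _ _))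

sum-take-++ˡ : ∀ xs ys {n} → n ≤ length xs → sum (take n (xs ++ ys)) ≡ sum (take n xs)
sum-take-++ˡ xs       ys {zero}  _         = refl
sum-take-++ˡ (x ∷ xs) ys {suc n} (s≤s n≤) = cong (x +_) (sum-take-++ˡ xs ys n≤)

sum-take-++ʳ : ∀ xs ys t → sum (take (length xs + t) (xs ++ ys)) ≡ sum xs + sum (take t ys)
sum-take-++ʳ []       ys t = refl
sum-take-++ʳ (x ∷ xs) ys t = trans (cong (x +_) (sum-take-++ʳ xs ys t)) (sym (+-assoc x _ _))

s≡sum-take : ∀ i n → n ≤ len i → s n ≡ sum (take n (Ablock i))
s≡sum-take i zero    _      = refl
s≡sum-take i (suc n) n<len =
  trans (cong₂ _+_ (s≡sum-take i n (<⇒≤ n<len)) (a≡at i n n<len)) (sym (sum-take-suc (Ablock i) n<len))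

s-block : ∀ i t → t ≤ len i → s (len i + t) ≡ sum (Ablock i) + s t
s-block i t t≤len = begin
  s (len i + t)                                    ≡⟨ s≡sum-take (suc i) (len i + t) in-next-block ⟩
  sum (take (len i + t) (Ablock i ++ B))           ≡⟨ sum-take-++ʳ (Ablock i) B t ⟩
  sum (Ablock i) + sum (take t B)                  ≡⟨ cong (sum (Ablock i) +_) (sum-take-++ˡ (Ablock i) _ t≤len) ⟩
  sum (Ablock i) + sum (take t (Ablock i))         ≡⟨ cong (sum (Ablock i) +_) (s≡sum-take i t t≤len) ⟨
  sum (Ablock i) + s t                             ∎
  where
    open ≡-Reasoning
    B = Ablock i ++ 1 ∷ []
    in-next-block : len i + t ≤ len (suc i)
    in-next-block =
      ≤-trans (+-monoʳ-≤ (len i) (≤-trans t≤len (m≤m+n (len i) 1))) (≤-reflexive (sym (len-suc i)))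

block-decomposition : ∀ i {j} → 1 ≤ j → j < len i → ∃ λ i′ → ∃ λ t → j ≡ len i′ + t × t ≤ len i′
block-decomposition zero    (s≤s z≤n) (s≤s ())
block-decomposition (suc i) {j} 1≤j j<len with len i ≤? j
... | yes len≤j = i , j ∸ len i , sym (m+[n∸m]≡n len≤j) , t≤len
  where
    j≤2len : j ≤ len i + len i
    j≤2len = ≤-pred (≤-trans j<len (≤-reflexive (trans (len-suc i) (trans (cong (len i +_) (+-comm (len i) 1))
                                                                      (+-suc (len i) (len i))))))
    t≤len : j ∸ len i ≤ len i
    t≤len = ≤-trans (∸-monoˡ-≤ (len i) j≤2len) (≤-reflexive (m+n∸m≡n (len i) (len i)))
... | no  j<len′ = block-decomposition i 1≤j (≰⇒> j<len′)

-- Profiles realising prefixes of A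

levelSum-⊕ : ∀ d d′ m → levelSum (d ⊕ d′) m ≡ levelSum d m + levelSum d′ m
levelSum-⊕ d d′ zero    = refl
levelSum-⊕ d d′ (suc m) rewrite levelSum-⊕ d d′ m =
  solve 4 (λ u u′ t t′ → u :+ u′ :+ (t :+ t′) := u :+ t :+ (u′ :+ t′)) refl
    (levelSum d m) (levelSum d′ m) (d (suc m)) (d′ (suc m))

saving-⊕ : ∀ d d′ m → saving (d ⊕ d′) m ≡ saving d m + saving d′ m
saving-⊕ d d′ zero    = refl
saving-⊕ d d′ (suc m) rewrite saving-⊕ d d′ m | levelSum-⊕ d d′ m =
  solve 4 (λ s s′ u u′ → con 2 :* (s :+ s′) :+ (u :+ u′) := con 2 :* s :+ u :+ (con 2 :* s′ :+ u′)) refl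
    (saving d m) (saving d′ m) (levelSum d m) (levelSum d′ m)

weight-⊕ : ∀ d d′ m → weight (d ⊕ d′) m ≡ weight d m + weight d′ m
weight-⊕ d d′ zero    = *-distribˡ-+ 2 (d 0) (d′ 0)
weight-⊕ d d′ (suc m) rewrite weight-⊕ d d′ m | levelSum-⊕ d d′ m =
  solve 6 (λ w w′ u u′ t t′ → con 2 :* (w :+ w′) :+ (u :+ u′) :+ con 2 :* (t :+ t′)
                              := con 2 :* w :+ u :+ con 2 :* t :+ (con 2 :* w′ :+ u′ :+ con 2 :* t′)) refl
    (weight d m) (weight d′ m) (levelSum d m) (levelSum d′ m) (d (suc m)) (d′ (suc m))

weight≡pebbles+saving : ∀ d m → weight d m ≡ pebbles d m + saving d m
weight≡pebbles+saving d zero    = sym (+-identityʳ _)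
weight≡pebbles+saving d (suc m) rewrite weight≡pebbles+saving d m =
  solve 4 (λ p s u t → con 2 :* (p :+ s) :+ u :+ con 2 :* t := con 2 :* t :+ (p :+ p) :+ (con 2 :* s :+ u)) refl
    (pebbles d m) (saving d m) (levelSum d m) (d (suc m))

levelSum-unit-below : ∀ m x → x < m → levelSum (single m 1) x ≡ 0
levelSum-unit-below m zero    0<m = single-other (<⇒≢ 0<m)
levelSum-unit-below m (suc x) x<m =
  cong₂ _+_ (levelSum-unit-below m x (<-trans (n<1+n x) x<m)) (single-other (<⇒≢ x<m))

unit-at-level : ∀ m → levelSum (single m 1) m ≡ 1 × saving (single m 1) m ≡ 0 × weight (single m 1) m ≡ 2
unit-at-level zero    = refl , refl , refl
unit-at-level (suc m) with levelSum≡0⇒saving≡0×weight≡0 (single (suc m) 1) m (levelSum-unit-below (suc m) m (n<1+n m))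
... | saving≡0 , weight≡0
  rewrite levelSum-unit-below (suc m) m (n<1+n m) | saving≡0 | weight≡0 | single-self m {1} = refl , refl , refl

unit-above-level : ∀ m t → levelSum (single m 1) (m + t) ≡ 1 × saving (single m 1) (m + t) + 1 ≡ 2 ^ t
                          × weight (single m 1) (m + t) + 1 ≡ 3 * 2 ^ t
unit-above-level m zero rewrite +-identityʳ m with unit-at-level m
... | levelSum≡1 , saving≡0 , weight≡2 rewrite levelSum≡1 | saving≡0 | weight≡2 = refl , refl , refl
unit-above-level m (suc t) rewrite +-suc m t with unit-above-level m t
... | levelSum≡1 , saving+1≡ , weight+1≡
  rewrite levelSum≡1 | single-other {m} {1} {suc (m + t)} (<⇒≢ (s≤s (m≤m+n m t)) ∘ sym) =
    refl ,
    trans (2*x+1+1≡2*[x+1] (saving u (m + t))) (cong (2 *_) saving+1≡) ,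
    trans (cong (_+ 1) (+-identityʳ (2 * weight u (m + t) + 1)))
          (trans (2*x+1+1≡2*[x+1] (weight u (m + t))) (trans (cong (2 *_) weight+1≡) (2*[3*p]≡3*[2*p] (2 ^ t))))
  where
    u = single m 1
    2*x+1+1≡2*[x+1] : ∀ x → 2 * x + 1 + 1 ≡ 2 * (x + 1)
    2*x+1+1≡2*[x+1] = solve 1 (λ x → con 2 :* x :+ con 1 :+ con 1 := con 2 :* (x :+ con 1)) refl

unit-profile : ∀ H i → suc i ≤ H →
               saving (single (H ∸ suc i) 1) H ≡ len i × weight (single (H ∸ suc i) 1) H ≡ sum (Ablock i)
unit-profile H i i<H = subst (λ K → saving u K ≡ len i × weight u K ≡ sum (Ablock i)) (m∸n+n≡m i<H) at-top
  where
    u = single (H ∸ suc i) 1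
    at-top : saving u (H ∸ suc i + suc i) ≡ len i × weight u (H ∸ suc i + suc i) ≡ sum (Ablock i)
    at-top = let _ , saving+1≡ , weight+1≡ = unit-above-level (H ∸ suc i) (suc i)
             in  +-cancelʳ-≡ _ _ _ (trans saving+1≡ (sym (len+1≡2^ i))) ,
                 +-cancelʳ-≡ _ _ _ (trans weight+1≡ (sym (sum+1≡3*2^ i)))

sum-Ablock≤2^⇒< : ∀ i H → sum (Ablock i) ≤ 2 ^ H → suc i ≤ H
sum-Ablock≤2^⇒< i H sum≤ with suc i ≤? H
... | yes i<H = i<H
... | no  i≮H = contradiction (≤-trans (2^suc≤sum-Ablock i) sum≤) (<⇒≱ (^-monoʳ-< 2 (s≤s (s≤s z≤n)) (≰⇒> i≮H)))

PrefixProfile : ℕ → ℕ → Set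
PrefixProfile H j = ∃ λ d → saving d H ≡ j × weight d H ≡ s j

prefix-profile : ∀ H j → s j ≤ 2 ^ H → PrefixProfile H j
prefix-profile H = <-rec (λ j → s j ≤ 2 ^ H → PrefixProfile H j) extend
  where
    extend : ∀ j → (∀ {t} → t < j → s t ≤ 2 ^ H → PrefixProfile H t) → s j ≤ 2 ^ H → PrefixProfile H j
    extend zero    _   _   = (λ _ → 0) , levelSum≡0⇒saving≡0×weight≡0 (λ _ → 0) H (levelSum-zero H)
    extend (suc j) rec sj≤ =
      let i , t , j≡ , t≤len = block-decomposition (suc j) (s≤s z≤n) (n<len (suc j))
          sj≡ = trans (cong s j≡) (s-block i t t≤len)
          sum+st≤2^H = subst (_≤ 2 ^ H) sj≡ sj≤
          d , saving≡t , weight≡st = rec (remainder< i j≡) (≤-trans (m≤n+m (s t) _) sum+st≤2^H)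
          i<H = sum-Ablock≤2^⇒< i H (≤-trans (m≤m+n _ (s t)) sum+st≤2^H)
          saving-unit , weight-unit = unit-profile H i i<H
          u = single (H ∸ suc i) 1
      in  d ⊕ u ,
          trans (saving-⊕ d u H) (trans (cong₂ _+_ saving≡t saving-unit) (trans (+-comm t (len i)) (sym j≡))) ,
          trans (weight-⊕ d u H) (trans (cong₂ _+_ weight≡st weight-unit) (trans (+-comm (s t) _) (sym sj≡)))
      where
        remainder< : ∀ i {t} → suc j ≡ len i + t → t < suc j
        remainder< i {t} j≡ = ≤-trans (+-monoˡ-≤ t (≤-trans (s≤s z≤n) (n<len i))) (≤-reflexive (sym j≡))

theorem3p4 : (h k p : ℕ) → IsKh h k → IsOptimalPebblingNumber (T h) p →
    p ≤ 2 ^ h ∸ k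
theorem3p4 h k p (sk≤2^h , _) (_ , optimal) with prefix-profile h k sk≤2^h
... | d , saving≡k , weight≡sk = begin
  p                                                      ≤⟨ optimal _ (layered-pebbles E budget) ⟩
  size (T h) ((single 0 E ⊕ layered d h 0) ∘ toℕ)        ≤⟨ size-layered h d E ⟩
  E + pebbles d h                                        ≡⟨ cong (λ w → 2 ^ h ∸ w + pebbles d h) (weight≡pebbles+saving d h) ⟩
  2 ^ h ∸ (pebbles d h + saving d h) + pebbles d h       ≡⟨ m∸[n+o]+n≡m∸o (2 ^ h) (pebbles d h) (saving d h) p+s≤2^h ⟩
  2 ^ h ∸ saving d h                                     ≡⟨ cong (2 ^ h ∸_) saving≡k ⟩
  2 ^ h ∸ k                                              ∎
  where
    open ≤-Reasoning
    open LayeredPebbling h d using (layered-pebbles)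
    E = 2 ^ h ∸ weight d h
    weight≤2^h : weight d h ≤ 2 ^ h
    weight≤2^h = subst (_≤ 2 ^ h) (sym weight≡sk) sk≤2^h
    budget : 2 ^ h ≤ E + weight d h
    budget = ≤-trans (m≤n+m∸n (2 ^ h) (weight d h)) (≤-reflexive (+-comm (weight d h) E))
    p+s≤2^h : pebbles d h + saving d h ≤ 2 ^ h
    p+s≤2^h = subst (_≤ 2 ^ h) (weight≡pebbles+saving d h) weight≤2^h
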